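{- Let $d\ge 1$ be an integer and let $T$ be the complete binary tree of depth $d$. Then \[\Phi_V(T)\ge \Big\lfloor \frac{d-\lceil \log_2(3d)\rceil}{2}\Big\rfloor \ge \frac{d-\log_2 d}{2}-\frac{3+\log_2 3}{2}.\]
   Context: The complete binary tree of depth $d$ is the rooted tree in which every vertex at distance less than $d$ from the root has exactly $2$ children, and the vertices at distance $d$ from the root are leaves. For a graph $G$ and $S\subseteq V(G)$, $\delta(S)=\{v\in V(G)\setminus S : N(v)\cap S\neq\emptyset\}$; $\Phi_V(G,s)=\min_{|S|=s}|\delta(S)|$ and $\Phi_V(G)=\max_{0\le s\le |V(G)|}\Phi_V(G,s)$. -}

module Defs where

open import Data.Nat as ℕ using (ℕ; suc; _^_; _∸_)
open import Data.Nat.Logarithm using (⌈log₂_⌉)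
open import Data.Bool using (Bool; true; false; _∧_; _∨_; not)
open import Data.Fin using (Fin; toℕ)
open import Data.Fin.Subset using (Subset; _∈_; ∣_∣)
open import Data.Fin.Subset.Properties using (_∈?_)
open import Data.Fin.Properties using (any?)
open import Data.Vec using (tabulate; lookup)
open import Data.Product using (∃; _×_)
open import Data.Integer as ℤ using (ℤ; +_)
open import Data.Integer.DivMod using (_/_)
open import Relation.Nullary using (does)
open import Relation.Binary.PropositionalEquality using (_≡_)

-- Complete binary tree of depth d, in heap numbering:
-- vertices are 0 .. 2^(d+1) - 2; vertex i has children 2i+1 and 2i+2.
-- Depth-k vertices are 2^k - 1 .. 2^(k+1) - 2, leaves are at depth d.
|T| : ℕ → ℕ
|T| d = 2 ^ suc d ∸ 1

Vertex : ℕ → Set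
Vertex d = Fin (|T| d)

isChild : ∀ {n} → Fin n → Fin n → Bool
isChild u v = (toℕ v ℕ.≡ᵇ 2 ℕ.* toℕ u ℕ.+ 1) ∨ (toℕ v ℕ.≡ᵇ 2 ℕ.* toℕ u ℕ.+ 2)

adj : ∀ {n} → Fin n → Fin n → Bool
adj u v = isChild u v ∨ isChild v u

anyFin : ∀ {n} → (Fin n → Bool) → Bool
anyFin {ℕ.zero} p = false
anyFin {suc n} p = p Data.Fin.zero ∨ anyFin (λ i → p (Data.Fin.suc i))

δ : ∀ {n} → Subset n → Subset n
δ S = tabulate λ v → not (does (v ∈? S)) ∧ anyFin (λ u → does (u ∈? S) ∧ adj u v)

-- Φ_V(T_d) ≥ k  : the maximum over s ∈ [0,|V|] of the minimum over |S| = s of |δ(S)|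
-- is at least k, i.e. some s admits k ≤ |δ(S)| for every S of size s.
ΦV≥ : ℕ → ℤ → Set
ΦV≥ d k = ∃ λ s → (s ℕ.≤ |T| d) × (∀ (S : Subset (|T| d)) → ∣ S ∣ ≡ s → k ℤ.≤ + ∣ δ S ∣)

-- the middle quantity  ⌊ (d - ⌈log₂(3d)⌉) / 2 ⌋  (floor division, may be negative)
bound : ℕ → ℤ
bound d = (+ d ℤ.- + ⌈log₂ (3 ℕ.* d) ⌉) / + 2

-- Let k = |δ(S)| and read the tree in heap numbering. Going down from the root, the subtree below a
-- vertex is full when the vertex or its parent lies in S, and empty otherwise, except for corrections
-- caused by boundary vertices, each of which costs at most one power of two and two units. Hence
-- |S| + N + c' = b (2^(d+1) - 1) + P + c with P, N sums of at most k powers of two and c + c' ≤ 2k.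
-- Adding a power of two changes the number of bit flips of a number inside a window of bits by at
-- most 2, adding a number at most 2^m changes the flips above bit m by at most 1, and adding 2^(d+1)
-- does not touch bits 0 .. d. So when 2k + 1 ≤ 2^m the bits m .. m + n of |S| flip at most 2k + 2
-- times. Taking |S| = 2^m * (n alternating bits) with m = ⌈log₂ 3d⌉ - 1 and n = d - m gives
-- n ≤ 2k + 2, which is the bound.

module Submission where

open import Defs
open import Data.Nat using (ℕ; _≤_; _^_; _*_)
open import Data.Integer as ℤ using (+_)
open import Data.Product using (_×_)

open import Data.Nat as ℕ using (zero; suc; _+_; _∸_; _<_; z≤n; s≤s; ⌊_/2⌋)
open import Data.Nat.Properties
open import Data.Nat.Induction using (<-wellFounded)
open import Data.Nat.Logarithm using (⌈log₂_⌉; ⌈log₂⌉-mono-≤; ⌈log₂2^n⌉≡n)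
open import Data.Nat.Logarithm.Core using (⌈log2⌉)
open import Data.Nat.Tactic.RingSolver using (solve-∀; solve)
open import Algebra.Properties.CommutativeSemigroup +-commutativeSemigroup using (xy∙z≈xz∙y)
open import Data.Integer using (-[1+_])
import Data.Integer.Properties as ℤP
open import Data.Integer.DivMod using (_/_; _%_; a≡a%n+[a/n]*n; n%d<d; [n/d]*d≤n)
import Data.Integer.Tactic.RingSolver as ZS
open import Data.Bool using (Bool; true; false; not; _∧_; _∨_; _xor_; T)
open import Data.Bool.Properties using (∨-zeroʳ; T-∨; T-∧)
import Data.List as List
open import Data.Vec using (Vec; _∷_; []; tabulate)
open import Data.Fin using (Fin; toℕ; fromℕ<)
import Data.Fin as Fin
open import Data.Fin.Properties using (toℕ-fromℕ<)
open import Data.Fin.Subset using (Subset; ∣_∣)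
open import Data.Fin.Subset.Properties using (_∈?_)
open import Data.Product using (_,_; proj₁; proj₂; ∃)
open import Data.Sum using (_⊎_; inj₁; inj₂)
import Data.Sum
open import Data.Empty using (⊥-elim)
open import Function.Bundles using (_⇔_; mk⇔; Equivalence)
open import Function.Properties.Equivalence using () renaming (trans to ⇔-trans; sym to ⇔-sym)
open import Induction.WellFounded using (Acc; acc)
open import Relation.Nullary using (does; yes; no; contradiction)
open import Relation.Binary.PropositionalEquality

-- Bit flips

⟦_⟧ : Bool → ℕ
⟦ true ⟧ = 1
⟦ false ⟧ = 0

⟦⟧≤1 : ∀ b → ⟦ b ⟧ ≤ 1
⟦⟧≤1 true = s≤s z≤n
⟦⟧≤1 false = z≤n

odd : ℕ → Bool
odd zero = false
odd (suc zero) = true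
odd (suc (suc n)) = odd n

_>>_ : ℕ → ℕ → ℕ
x >> zero = x
x >> suc m = ⌊ x /2⌋ >> m

flips : ℕ → ℕ → ℕ
flips zero x = 0
flips (suc n) x = ⟦ odd x xor odd ⌊ x /2⌋ ⟧ + flips n ⌊ x /2⌋

Close : ℕ → ℕ → ℕ → Set
Close k a b = (a ≤ b + k) × (b ≤ a + k)

close-refl : ∀ {k a} → Close k a a
close-refl {k} {a} = m≤m+n a k , m≤m+n a k

close-mono : ∀ {j k a b} → j ≤ k → Close j a b → Close k a b
close-mono {a = a} {b} j≤k (p , q) =
  ≤-trans p (+-monoʳ-≤ b j≤k) , ≤-trans q (+-monoʳ-≤ a j≤k)

close-trans : ∀ {j k a b c} → Close j a b → Close k b c → Close (j + k) a c
close-trans {j} {k} {a} {b} {c} (a≤ , b≤) (b≤′ , c≤) =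
  ≤-trans a≤ (≤-trans (+-monoˡ-≤ j b≤′) (≤-reflexive (reassoc c k j))) ,
  ≤-trans c≤ (≤-trans (+-monoˡ-≤ k b≤) (≤-reflexive (+-assoc a j k)))
  where
  reassoc : ∀ c k j → c + k + j ≡ c + (j + k)
  reassoc = solve-∀

close-+ : ∀ {j k a b c e} → Close j a b → Close k c e → Close (j + k) (a + c) (b + e)
close-+ {j} {k} {a} {b} {c} {e} (p , q) (r , s) =
  ≤-trans (+-mono-≤ p r) (≤-reflexive (interchange b j e k)) ,
  ≤-trans (+-mono-≤ q s) (≤-reflexive (interchange a j c k))
  where
  interchange : ∀ x y z w → x + y + (z + w) ≡ x + z + (y + w)
  interchange = solve-∀

close-bits : ∀ a b → Close 1 ⟦ a ⟧ ⟦ b ⟧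
close-bits a b = ≤-trans (⟦⟧≤1 a) (m≤n+m 1 _) , ≤-trans (⟦⟧≤1 b) (m≤n+m 1 _)

odd-suc : ∀ x → odd (suc x) ≡ not (odd x)
odd-suc zero = refl
odd-suc (suc zero) = refl
odd-suc (suc (suc x)) = odd-suc x

⌊1+n/2⌋-odd : ∀ x → odd x ≡ true → ⌊ suc x /2⌋ ≡ suc ⌊ x /2⌋
⌊1+n/2⌋-odd (suc zero) _ = refl
⌊1+n/2⌋-odd (suc (suc x)) e = cong suc (⌊1+n/2⌋-odd x e)

⌊1+n/2⌋-even : ∀ x → odd x ≡ false → ⌊ suc x /2⌋ ≡ ⌊ x /2⌋
⌊1+n/2⌋-even zero _ = refl
⌊1+n/2⌋-even (suc (suc x)) e = cong suc (⌊1+n/2⌋-even x e)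

⌊m+m+n/2⌋≡m+⌊n/2⌋ : ∀ m n → ⌊ m + m + n /2⌋ ≡ m + ⌊ n /2⌋
⌊m+m+n/2⌋≡m+⌊n/2⌋ zero n = refl
⌊m+m+n/2⌋≡m+⌊n/2⌋ (suc m) n rewrite +-suc m m = cong suc (⌊m+m+n/2⌋≡m+⌊n/2⌋ m n)

odd[m+m+n]≡odd[n] : ∀ m n → odd (m + m + n) ≡ odd n
odd[m+m+n]≡odd[n] zero n = refl
odd[m+m+n]≡odd[n] (suc m) n rewrite +-suc m m = odd[m+m+n]≡odd[n] m n

n≡⌊n/2⌋+⌊n/2⌋+odd[n] : ∀ n → n ≡ ⌊ n /2⌋ + ⌊ n /2⌋ + ⟦ odd n ⟧
n≡⌊n/2⌋+⌊n/2⌋+odd[n] zero = refl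
n≡⌊n/2⌋+⌊n/2⌋+odd[n] (suc zero) = refl
n≡⌊n/2⌋+⌊n/2⌋+odd[n] (suc (suc n)) =
  trans (cong (λ t → suc (suc t)) (n≡⌊n/2⌋+⌊n/2⌋+odd[n] n))
        (cong (λ t → suc (t + ⟦ odd n ⟧)) (sym (+-suc ⌊ n /2⌋ ⌊ n /2⌋)))

2^[1+n]≡2^n+2^n : ∀ n → 2 ^ suc n ≡ 2 ^ n + 2 ^ n
2^[1+n]≡2^n+2^n n = cong (λ t → 2 ^ n + t) (+-identityʳ (2 ^ n))

flips-suc : ∀ m n x → Close 1 (flips n (suc x >> m)) (flips n (x >> m))
flips-suc (suc m) n x with odd x in eq
... | true rewrite ⌊1+n/2⌋-odd x eq = flips-suc m n ⌊ x /2⌋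
... | false rewrite ⌊1+n/2⌋-even x eq = close-refl
flips-suc zero zero x = close-refl
flips-suc zero (suc n) x with odd x in eq
... | true rewrite ⌊1+n/2⌋-odd x eq | odd-suc x | eq | odd-suc ⌊ x /2⌋ =
  close-+ {j = 0} close-refl (flips-suc zero n ⌊ x /2⌋)
... | false rewrite ⌊1+n/2⌋-even x eq | odd-suc x | eq =
  close-+ {k = 0} (close-bits (true xor odd ⌊ x /2⌋) (false xor odd ⌊ x /2⌋)) close-refl

flips-+2^ : ∀ a m n x → Close 2 (flips n ((2 ^ a + x) >> m)) (flips n (x >> m))
flips-+2^ zero m n x = close-mono (s≤s z≤n) (flips-suc m n x)
flips-+2^ (suc a) (suc m) n x
  rewrite 2^[1+n]≡2^n+2^n a | ⌊m+m+n/2⌋≡m+⌊n/2⌋ (2 ^ a) x = flips-+2^ a m n ⌊ x /2⌋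
flips-+2^ (suc a) zero zero x = close-refl
flips-+2^ (suc a) zero (suc n) x
  rewrite 2^[1+n]≡2^n+2^n a | ⌊m+m+n/2⌋≡m+⌊n/2⌋ (2 ^ a) x | odd[m+m+n]≡odd[n] (2 ^ a) x = carry a
  where
  -- Adding 2^a to ⌊x/2⌋ changes bit 1 of x only for a = 0, and then the rest changes by a carry.
  carry : ∀ a → Close 2 (⟦ odd x xor odd (2 ^ a + ⌊ x /2⌋) ⟧ + flips n (2 ^ a + ⌊ x /2⌋))
                        (⟦ odd x xor odd ⌊ x /2⌋ ⟧ + flips n ⌊ x /2⌋)
  carry zero = close-+ (close-bits _ _) (flips-suc zero n ⌊ x /2⌋)
  carry (suc a) rewrite 2^[1+n]≡2^n+2^n a | odd[m+m+n]≡odd[n] (2 ^ a) ⌊ x /2⌋ | sym (2^[1+n]≡2^n+2^n a) =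
    close-+ {j = 0} close-refl (flips-+2^ (suc a) zero n ⌊ x /2⌋)

flips-+2^-high : ∀ M m n x → m + n < M → flips n ((2 ^ M + x) >> m) ≡ flips n (x >> m)
flips-+2^-high (suc M) (suc m) n x (s≤s m+n<M)
  rewrite 2^[1+n]≡2^n+2^n M | ⌊m+m+n/2⌋≡m+⌊n/2⌋ (2 ^ M) x = flips-+2^-high M m n ⌊ x /2⌋ m+n<M
flips-+2^-high M zero zero x _ = refl
flips-+2^-high (suc (suc M)) zero (suc n) x (s≤s n<1+M)
  rewrite 2^[1+n]≡2^n+2^n (suc M) | ⌊m+m+n/2⌋≡m+⌊n/2⌋ (2 ^ suc M) x | odd[m+m+n]≡odd[n] (2 ^ suc M) x
        | 2^[1+n]≡2^n+2^n M | odd[m+m+n]≡odd[n] (2 ^ M) ⌊ x /2⌋ | sym (2^[1+n]≡2^n+2^n M) =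
  cong (λ t → ⟦ odd x xor odd ⌊ x /2⌋ ⟧ + t) (flips-+2^-high (suc M) zero n ⌊ x /2⌋ n<1+M)

flips-0 : ∀ m n → flips n (0 >> m) ≡ 0
flips-0 (suc m) n = flips-0 m n
flips-0 zero zero = refl
flips-0 zero (suc n) = flips-0 zero n

⌊m+n/2⌋≡⌊m/2⌋+carry+⌊n/2⌋ : ∀ m n → ⌊ m + n /2⌋ ≡ ⌊ m /2⌋ + ⟦ odd m ∧ odd n ⟧ + ⌊ n /2⌋
⌊m+n/2⌋≡⌊m/2⌋+carry+⌊n/2⌋ m n = begin
  ⌊ m + n /2⌋
    ≡⟨ cong ⌊_/2⌋ (cong₂ _+_ (n≡⌊n/2⌋+⌊n/2⌋+odd[n] m) (n≡⌊n/2⌋+⌊n/2⌋+odd[n] n)) ⟩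
  ⌊ (hm + hm + ⟦ odd m ⟧) + (hn + hn + ⟦ odd n ⟧) /2⌋
    ≡⟨ cong ⌊_/2⌋ (regroup hm hn ⟦ odd m ⟧ ⟦ odd n ⟧) ⟩
  ⌊ (hm + hn) + (hm + hn) + (⟦ odd m ⟧ + ⟦ odd n ⟧) /2⌋
    ≡⟨ ⌊m+m+n/2⌋≡m+⌊n/2⌋ (hm + hn) (⟦ odd m ⟧ + ⟦ odd n ⟧) ⟩
  hm + hn + ⌊ ⟦ odd m ⟧ + ⟦ odd n ⟧ /2⌋
    ≡⟨ cong (λ t → hm + hn + t) (⌊[a]+[b]/2⌋ (odd m) (odd n)) ⟩
  hm + hn + ⟦ odd m ∧ odd n ⟧
    ≡⟨ xy∙z≈xz∙y hm hn _ ⟩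
  hm + ⟦ odd m ∧ odd n ⟧ + hn ∎
  where
  open ≡-Reasoning
  hm hn : ℕ
  hm = ⌊ m /2⌋
  hn = ⌊ n /2⌋
  regroup : ∀ a b p q → (a + a + p) + (b + b + q) ≡ (a + b) + (a + b) + (p + q)
  regroup = solve-∀
  ⌊[a]+[b]/2⌋ : ∀ a b → ⌊ ⟦ a ⟧ + ⟦ b ⟧ /2⌋ ≡ ⟦ a ∧ b ⟧
  ⌊[a]+[b]/2⌋ true true = refl
  ⌊[a]+[b]/2⌋ true false = refl
  ⌊[a]+[b]/2⌋ false true = refl
  ⌊[a]+[b]/2⌋ false false = refl

⌊n/2⌋+carry≤⌈n/2⌉ : ∀ n b → ⌊ n /2⌋ + ⟦ odd n ∧ b ⟧ ≤ ℕ.⌈ n /2⌉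
⌊n/2⌋+carry≤⌈n/2⌉ zero b = z≤n
⌊n/2⌋+carry≤⌈n/2⌉ (suc zero) b = ⟦⟧≤1 b
⌊n/2⌋+carry≤⌈n/2⌉ (suc (suc n)) b = s≤s (⌊n/2⌋+carry≤⌈n/2⌉ n b)

⌈m+m/2⌉≡m : ∀ m → ℕ.⌈ m + m /2⌉ ≡ m
⌈m+m/2⌉≡m zero = refl
⌈m+m/2⌉≡m (suc m) rewrite +-suc m m = cong suc (⌈m+m/2⌉≡m m)

flips-+≤2^ : ∀ m n c x → c ≤ 2 ^ m → Close 1 (flips n ((c + x) >> m)) (flips n (x >> m))
flips-+≤2^ zero n zero x _ = close-refl
flips-+≤2^ zero n (suc zero) x _ = flips-suc zero n x
flips-+≤2^ zero n (suc (suc c)) x (s≤s ())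
flips-+≤2^ (suc m) n c x c≤2^[1+m] rewrite ⌊m+n/2⌋≡⌊m/2⌋+carry+⌊n/2⌋ c x =
  flips-+≤2^ m n _ ⌊ x /2⌋ (begin
    ⌊ c /2⌋ + ⟦ odd c ∧ odd x ⟧ ≤⟨ ⌊n/2⌋+carry≤⌈n/2⌉ c (odd x) ⟩
    ℕ.⌈ c /2⌉                    ≤⟨ ⌈n/2⌉-mono (subst (c ≤_) (2^[1+n]≡2^n+2^n m) c≤2^[1+m]) ⟩
    ℕ.⌈ 2 ^ m + 2 ^ m /2⌉        ≡⟨ ⌈m+m/2⌉≡m (2 ^ m) ⟩
    2 ^ m                        ∎)
  where open ≤-Reasoning

data PowerSum : ℕ → ℕ → Set where
  none : ∀ {j} → PowerSum j 0
  add  : ∀ {j x} a → PowerSum j x → PowerSum (suc j) (2 ^ a + x)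

PowerSum-mono : ∀ {j k x} → j ≤ k → PowerSum j x → PowerSum k x
PowerSum-mono _ none = none
PowerSum-mono (s≤s j≤k) (add a p) = add a (PowerSum-mono j≤k p)

PowerSum-+ : ∀ {j k x y} → PowerSum j x → PowerSum k y → PowerSum (j + k) (x + y)
PowerSum-+ {j} {k} none q = PowerSum-mono (m≤n+m k j) q
PowerSum-+ {y = y} (add {x = x} a p) q =
  subst (PowerSum _) (sym (+-assoc (2 ^ a) x y)) (add a (PowerSum-+ p q))

flips-+PowerSum : ∀ {j y} m n x → PowerSum j y → Close (2 * j) (flips n ((y + x) >> m)) (flips n (x >> m))
flips-+PowerSum m n x none = close-refl
flips-+PowerSum {suc j} m n x (add {x = y} a p) rewrite +-assoc (2 ^ a) y x =
  close-mono (≤-reflexive (sym (*-suc 2 j)))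
    (close-trans (flips-+2^ a m n (y + x)) (flips-+PowerSum m n x p))

alternating : ℕ → ℕ
alternating zero = 0
alternating (suc n) = alternating n + alternating n + ⟦ not (odd (alternating n)) ⟧

flips-alternating : ∀ n → flips n (alternating n) ≡ n
flips-alternating zero = refl
flips-alternating (suc n)
  rewrite ⌊m+m+n/2⌋≡m+⌊n/2⌋ (alternating n) ⟦ not (odd (alternating n)) ⟧
        | odd[m+m+n]≡odd[n] (alternating n) ⟦ not (odd (alternating n)) ⟧ = lowBit (odd (alternating n)) refl
  where
  a : ℕ
  a = alternating n
  lowBit : ∀ o → odd a ≡ o →
           ⟦ odd ⟦ not o ⟧ xor odd (a + ⌊ ⟦ not o ⟧ /2⌋) ⟧ + flips n (a + ⌊ ⟦ not o ⟧ /2⌋) ≡ suc n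
  lowBit true e rewrite +-identityʳ a | e = cong suc (flips-alternating n)
  lowBit false e rewrite +-identityʳ a | e = cong suc (flips-alternating n)

alternating<2^ : ∀ n → alternating n < 2 ^ n
alternating<2^ zero = s≤s z≤n
alternating<2^ (suc n) = begin-strict
  a + a + ⟦ not (odd a) ⟧ ≤⟨ +-monoʳ-≤ (a + a) (⟦⟧≤1 _) ⟩
  a + a + 1               <⟨ ≤-reflexive (shape a) ⟩
  2 * suc a               ≤⟨ *-monoʳ-≤ 2 (alternating<2^ n) ⟩
  2 ^ suc n               ∎
  where
  open ≤-Reasoning
  a : ℕ
  a = alternating n
  shape : ∀ a → suc (a + a + 1) ≡ 2 * suc a
  shape = solve-∀

[2^m*n]>>m≡n : ∀ m n → (2 ^ m * n) >> m ≡ n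
[2^m*n]>>m≡n zero n = +-identityʳ n
[2^m*n]>>m≡n (suc m) n = begin
  ⌊ 2 * 2 ^ m * n /2⌋ >> m         ≡⟨ cong (λ t → ⌊ t /2⌋ >> m) (double (2 ^ m) n) ⟩
  ⌊ 2 ^ m * n + 2 ^ m * n + 0 /2⌋ >> m ≡⟨ cong (_>> m) (⌊m+m+n/2⌋≡m+⌊n/2⌋ (2 ^ m * n) 0) ⟩
  (2 ^ m * n + 0) >> m              ≡⟨ cong (_>> m) (+-identityʳ _) ⟩
  (2 ^ m * n) >> m                  ≡⟨ [2^m*n]>>m≡n m n ⟩
  n                                 ∎
  where
  open ≡-Reasoning
  double : ∀ q n → 2 * q * n ≡ q * n + q * n + 0
  double = solve-∀

-- Counting a subset along the subtrees

treeSize : ℕ → ℕ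
treeSize zero = 1
treeSize (suc h) = suc (treeSize h + treeSize h)

2^[1+h]≡1+treeSize[h] : ∀ h → 2 ^ suc h ≡ suc (treeSize h)
2^[1+h]≡1+treeSize[h] zero = refl
2^[1+h]≡1+treeSize[h] (suc h) = begin
  2 ^ suc (suc h)                       ≡⟨ 2^[1+n]≡2^n+2^n (suc h) ⟩
  2 ^ suc h + 2 ^ suc h                 ≡⟨ cong (λ t → t + t) (2^[1+h]≡1+treeSize[h] h) ⟩
  suc (treeSize h) + suc (treeSize h)   ≡⟨ cong suc (+-suc (treeSize h) (treeSize h)) ⟩
  suc (treeSize (suc h))                ∎
  where open ≡-Reasoning

|T|≡treeSize : ∀ d → |T| d ≡ treeSize d
|T|≡treeSize d = cong (_∸ 1) (2^[1+h]≡1+treeSize[h] d)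

PowerSum-1+treeSize : ∀ h → PowerSum 1 (suc (treeSize h))
PowerSum-1+treeSize h =
  subst (PowerSum 1) (trans (+-identityʳ _) (2^[1+h]≡1+treeSize[h] h)) (add (suc h) none)

record Approx (k x y : ℕ) : Set where
  constructor approx
  field
    jP jN P N cP cN : ℕ
    P-sum   : PowerSum jP P
    N-sum   : PowerSum jN N
    j-bound : jP + jN ≤ k
    c-bound : cP + cN ≤ 2 * k
    balance : x + N + cN ≡ y + P + cP

Approx-exact : ∀ {k x y} → x ≡ y → Approx k x y
Approx-exact x≡y = approx 0 0 0 0 0 0 none none z≤n z≤n (cong (λ t → t + 0 + 0) x≡y)

Approx-combine : ∀ {k₀ k₁ k₂ a x₁ x₂ y₁ y₂ z} →
  Approx k₀ (a + (y₁ + y₂)) z → Approx k₁ x₁ y₁ → Approx k₂ x₂ y₂ →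
  Approx (k₀ + (k₁ + k₂)) (a + (x₁ + x₂)) z
Approx-combine {k₀} {k₁} {k₂} {a} {x₁} {x₂} {y₁} {y₂} {z}
  (approx jP₀ jN₀ P₀ N₀ cP₀ cN₀ p₀ n₀ j₀ c₀ e₀)
  (approx jP₁ jN₁ P₁ N₁ cP₁ cN₁ p₁ n₁ j₁ c₁ e₁)
  (approx jP₂ jN₂ P₂ N₂ cP₂ cN₂ p₂ n₂ j₂ c₂ e₂) =
  approx (jP₀ + (jP₁ + jP₂)) (jN₀ + (jN₁ + jN₂)) (P₀ + (P₁ + P₂)) (N₀ + (N₁ + N₂))
         (cP₀ + (cP₁ + cP₂)) (cN₀ + (cN₁ + cN₂))
         (PowerSum-+ p₀ (PowerSum-+ p₁ p₂)) (PowerSum-+ n₀ (PowerSum-+ n₁ n₂))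
         (subst (_≤ k₀ + (k₁ + k₂)) (shuffle jP₀ jP₁ jP₂ jN₀ jN₁ jN₂) (+-mono-≤ j₀ (+-mono-≤ j₁ j₂)))
         (subst₂ _≤_ (shuffle cP₀ cP₁ cP₂ cN₀ cN₁ cN₂) (distrib k₀ k₁ k₂) (+-mono-≤ c₀ (+-mono-≤ c₁ c₂)))
         (+-cancelʳ-≡ (y₁ + y₂) _ _ (begin
            a + (x₁ + x₂) + (N₀ + (N₁ + N₂)) + (cN₀ + (cN₁ + cN₂)) + (y₁ + y₂)
              ≡⟨ sumˡ a x₁ x₂ y₁ y₂ N₀ N₁ N₂ cN₀ cN₁ cN₂ ⟩
            (a + (y₁ + y₂) + N₀ + cN₀) + (x₁ + N₁ + cN₁) + (x₂ + N₂ + cN₂)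
              ≡⟨ cong₂ _+_ (cong₂ _+_ e₀ e₁) e₂ ⟩
            (z + P₀ + cP₀) + (y₁ + P₁ + cP₁) + (y₂ + P₂ + cP₂)
              ≡⟨ sumʳ z y₁ y₂ P₀ P₁ P₂ cP₀ cP₁ cP₂ ⟩
            z + (P₀ + (P₁ + P₂)) + (cP₀ + (cP₁ + cP₂)) + (y₁ + y₂) ∎))
  where
  open ≡-Reasoning
  shuffle : ∀ a b c d e f → (a + d) + ((b + e) + (c + f)) ≡ (a + (b + c)) + (d + (e + f))
  shuffle = solve-∀
  distrib : ∀ a b c → 2 * a + (2 * b + 2 * c) ≡ 2 * (a + (b + c))
  distrib = solve-∀
  sumˡ : ∀ a x₁ x₂ y₁ y₂ N₀ N₁ N₂ c₀ c₁ c₂ →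
         a + (x₁ + x₂) + (N₀ + (N₁ + N₂)) + (c₀ + (c₁ + c₂)) + (y₁ + y₂)
         ≡ (a + (y₁ + y₂) + N₀ + c₀) + (x₁ + N₁ + c₁) + (x₂ + N₂ + c₂)
  sumˡ = solve-∀
  sumʳ : ∀ z y₁ y₂ P₀ P₁ P₂ c₀ c₁ c₂ →
         (z + P₀ + c₀) + (y₁ + P₁ + c₁) + (y₂ + P₂ + c₂)
         ≡ z + (P₀ + (P₁ + P₂)) + (c₀ + (c₁ + c₂)) + (y₁ + y₂)
  sumʳ = solve-∀

-- a vertex with membership a, whose parent and children have memberships p, l and r
inBoundary : Bool → Bool → Bool → Bool → Bool
inBoundary a p l r = not a ∧ (p ∨ l ∨ r)

Approx-leaf : ∀ a p {l r} → l ≡ false → r ≡ false → Approx ⟦ inBoundary a p l r ⟧ ⟦ a ⟧ (⟦ a ∨ p ⟧ * 1)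
Approx-leaf true p refl refl = Approx-exact refl
Approx-leaf false false refl refl = Approx-exact refl
Approx-leaf false true refl refl = approx 0 0 0 0 0 1 none none z≤n (s≤s z≤n) refl

-- Each child subtree (of size s) is counted as full exactly when the child or the vertex itself is in
-- the set; the boundary indicator of the vertex pays for the error.
Approx-node : ∀ {s} → PowerSum 1 (suc s) → PowerSum 1 (suc (suc (s + s))) → ∀ a p l r →
  Approx ⟦ inBoundary a p l r ⟧ (⟦ a ⟧ + (⟦ l ∨ a ⟧ * s + ⟦ r ∨ a ⟧ * s)) (⟦ a ∨ p ⟧ * suc (s + s))
Approx-node {s} _ _ true p l r rewrite ∨-zeroʳ l | ∨-zeroʳ r = Approx-exact (solve (s List.∷ List.[]))
Approx-node _ _ false false false false = Approx-exact refl
Approx-node {s} q _ false false true false =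
  approx 1 0 _ 0 0 1 q none ≤-refl (s≤s z≤n) (solve (s List.∷ List.[]))
Approx-node {s} q _ false false false true =
  approx 1 0 _ 0 0 1 q none ≤-refl (s≤s z≤n) (solve (s List.∷ List.[]))
Approx-node {s} _ q false false true true =
  approx 1 0 _ 0 0 2 q none ≤-refl (s≤s (s≤s z≤n)) (solve (s List.∷ List.[]))
Approx-node {s} _ q false true false false =
  approx 0 1 0 _ 1 0 none q ≤-refl (s≤s z≤n) (solve (s List.∷ List.[]))
Approx-node {s} q _ false true true false =
  approx 0 1 0 _ 0 0 none q ≤-refl z≤n (solve (s List.∷ List.[]))
Approx-node {s} q _ false true false true =
  approx 0 1 0 _ 0 0 none q ≤-refl z≤n (solve (s List.∷ List.[]))
Approx-node {s} _ _ false true true true =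
  approx 0 0 0 0 0 1 none none z≤n (s≤s z≤n) (solve (s List.∷ List.[]))

left right : ℕ → ℕ
left i = suc (i + i)
right i = suc (suc (i + i))

subtreeSum : (ℕ → ℕ) → ℕ → ℕ → ℕ
subtreeSum g u zero = g u
subtreeSum g u (suc h) = g u + (subtreeSum g (left u) h + subtreeSum g (right u) h)

module Subtrees (f : ℕ → Bool) (d : ℕ) (f-out : ∀ i → treeSize d ≤ i → f i ≡ false) where

  parentIn : ℕ → Bool
  parentIn zero = false
  parentIn (suc i) = f ⌊ i /2⌋

  boundary : ℕ → Bool
  boundary i = inBoundary (f i) (parentIn i) (f (left i)) (f (right i))

  parentIn-left : ∀ u → parentIn (left u) ≡ f u
  parentIn-left u = cong f (trans (cong ⌊_/2⌋ (sym (+-identityʳ (u + u))))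
                                  (trans (⌊m+m+n/2⌋≡m+⌊n/2⌋ u 0) (+-identityʳ u)))

  parentIn-right : ∀ u → parentIn (right u) ≡ f u
  parentIn-right u = cong f (trans (cong ⌊_/2⌋ (sym (+-comm (u + u) 1)))
                                   (trans (⌊m+m+n/2⌋≡m+⌊n/2⌋ u 1) (+-identityʳ u)))

  -- 2 ^ d ≤ (1 + u) * 2 ^ h says that the subtree of height h at u reaches the leaves.
  subtree-Approx : ∀ h u → 2 ^ d ≤ suc u * 2 ^ h →
    Approx (subtreeSum (λ i → ⟦ boundary i ⟧) u h) (subtreeSum (λ i → ⟦ f i ⟧) u h)
           (⟦ f u ∨ parentIn u ⟧ * treeSize h)
  subtree-Approx zero u reaches =
    Approx-leaf (f u) (parentIn u) (f-out (left u) left-outside) (f-out (right u) (m≤n⇒m≤1+n left-outside))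
    where
    left-outside : treeSize d ≤ left u
    left-outside = ≤-pred (subst₂ _≤_ (2^[1+h]≡1+treeSize[h] d) (double u)
                                     (*-monoʳ-≤ 2 (subst (2 ^ d ≤_) (*-identityʳ (suc u)) reaches)))
      where double : ∀ v → 2 * suc v ≡ suc (suc (v + v))
            double = solve-∀
  subtree-Approx (suc h) u reaches =
    Approx-combine {a = ⟦ f u ⟧}
      (Approx-node (PowerSum-1+treeSize h) (PowerSum-1+treeSize (suc h))
                   (f u) (parentIn u) (f (left u)) (f (right u)))
      (child left parentIn-left left-reaches)
      (child right parentIn-right (≤-trans left-reaches (*-monoˡ-≤ (2 ^ h) (n≤1+n (suc (left u))))))
    where
    left-reaches : 2 ^ d ≤ suc (left u) * 2 ^ h
    left-reaches = subst (2 ^ d ≤_) (regroup u (2 ^ h)) reaches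
      where regroup : ∀ v q → suc v * (2 * q) ≡ suc (suc (v + v)) * q
            regroup = solve-∀
    child : ∀ c → (∀ u → parentIn (c u) ≡ f u) → 2 ^ d ≤ suc (c u) * 2 ^ h →
            Approx (subtreeSum (λ i → ⟦ boundary i ⟧) (c u) h) (subtreeSum (λ i → ⟦ f i ⟧) (c u) h)
                   (⟦ f (c u) ∨ f u ⟧ * treeSize h)
    child c parentIn-c c-reaches =
      subst (λ b → Approx (subtreeSum (λ i → ⟦ boundary i ⟧) (c u) h) (subtreeSum (λ i → ⟦ f i ⟧) (c u) h)
                          (⟦ f (c u) ∨ b ⟧ * treeSize h))
            (parentIn-c u) (subtree-Approx h (c u) c-reaches)

sumFrom : (ℕ → ℕ) → ℕ → ℕ → ℕ
sumFrom g a zero = 0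
sumFrom g a (suc n) = g a + sumFrom g (suc a) n

sumFrom-+ : ∀ g a m n → sumFrom g a (m + n) ≡ sumFrom g a m + sumFrom g (a + m) n
sumFrom-+ g a zero n = cong (λ t → sumFrom g t n) (sym (+-identityʳ a))
sumFrom-+ g a (suc m) n = begin
  g a + sumFrom g (suc a) (m + n)
    ≡⟨ cong (λ t → g a + t) (sumFrom-+ g (suc a) m n) ⟩
  g a + (sumFrom g (suc a) m + sumFrom g (suc a + m) n)
    ≡⟨ sym (+-assoc (g a) _ _) ⟩
  g a + sumFrom g (suc a) m + sumFrom g (suc a + m) n
    ≡⟨ cong (λ t → g a + sumFrom g (suc a) m + sumFrom g t n) (sym (+-suc a m)) ⟩
  g a + sumFrom g (suc a) m + sumFrom g (a + suc m) n ∎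
  where open ≡-Reasoning

sumFrom-suc : ∀ g a n → sumFrom g (suc a) n ≡ sumFrom (λ i → g (suc i)) a n
sumFrom-suc g a zero = refl
sumFrom-suc g a (suc n) = cong (λ t → g (suc a) + t) (sumFrom-suc g (suc a) n)

sumFrom-cong : ∀ {g g′} a n → (∀ i → i < a + n → g i ≡ g′ i) → sumFrom g a n ≡ sumFrom g′ a n
sumFrom-cong a zero _ = refl
sumFrom-cong a (suc n) g≡g′ =
  cong₂ _+_ (g≡g′ a (subst (a <_) (sym (+-suc a n)) (s≤s (m≤m+n a n))))
            (sumFrom-cong (suc a) n (λ i i< → g≡g′ i (subst (i <_) (sym (+-suc a n)) i<)))

levelSum : (ℕ → ℕ) → ℕ → ℕ → ℕ
levelSum g u zero = g u
levelSum g u (suc j) = levelSum g (left u) j + levelSum g (right u) j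

-- The descendants of u at distance j are the 2 ^ j consecutive vertices from 2 ^ j * (1 + u) - 1 on.
levelSum≡sumFrom : ∀ g j u a → suc a ≡ 2 ^ j * suc u → levelSum g u j ≡ sumFrom g a (2 ^ j)
levelSum≡sumFrom g zero u a e rewrite +-identityʳ u | suc-injective e = sym (+-identityʳ (g u))
levelSum≡sumFrom g (suc j) u a e = begin
  levelSum g (left u) j + levelSum g (right u) j
    ≡⟨ cong₂ _+_ (levelSum≡sumFrom g j (left u) a first) (levelSum≡sumFrom g j (right u) (a + 2 ^ j) second) ⟩
  sumFrom g a (2 ^ j) + sumFrom g (a + 2 ^ j) (2 ^ j)   ≡⟨ sym (sumFrom-+ g a (2 ^ j) (2 ^ j)) ⟩
  sumFrom g a (2 ^ j + 2 ^ j)                           ≡⟨ cong (sumFrom g a) (sym (2^[1+n]≡2^n+2^n j)) ⟩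
  sumFrom g a (2 ^ suc j)                               ∎
  where
  open ≡-Reasoning
  first : suc a ≡ 2 ^ j * suc (left u)
  first = trans e (shape (2 ^ j) u)
    where shape : ∀ q v → 2 * q * suc v ≡ q * suc (suc (v + v))
          shape = solve-∀
  second : suc (a + 2 ^ j) ≡ 2 ^ j * suc (right u)
  second = trans (cong (_+ 2 ^ j) e) (shape (2 ^ j) u)
    where shape : ∀ q v → 2 * q * suc v + q ≡ q * suc (suc (suc (v + v)))
          shape = solve-∀

subtreeSum-suc : ∀ g h u → subtreeSum g u (suc h) ≡ subtreeSum g u h + levelSum g u (suc h)
subtreeSum-suc g zero u = refl
subtreeSum-suc g (suc h) u = begin
  g u + (subtreeSum g (left u) (suc h) + subtreeSum g (right u) (suc h))
    ≡⟨ cong₂ (λ x y → g u + (x + y)) (subtreeSum-suc g h (left u)) (subtreeSum-suc g h (right u)) ⟩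
  g u + ((subtreeSum g (left u) h + levelSum g (left u) (suc h)) +
         (subtreeSum g (right u) h + levelSum g (right u) (suc h)))
    ≡⟨ regroup (g u) (subtreeSum g (left u) h) (subtreeSum g (right u) h) _ _ ⟩
  g u + (subtreeSum g (left u) h + subtreeSum g (right u) h) +
    (levelSum g (left u) (suc h) + levelSum g (right u) (suc h)) ∎
  where
  open ≡-Reasoning
  regroup : ∀ a b c x y → a + ((b + x) + (c + y)) ≡ a + (b + c) + (x + y)
  regroup = solve-∀

sumFrom≡subtreeSum : ∀ g h → sumFrom g 0 (treeSize h) ≡ subtreeSum g 0 h
sumFrom≡subtreeSum g zero = +-identityʳ (g 0)
sumFrom≡subtreeSum g (suc h) = begin
  sumFrom g 0 (treeSize (suc h))
    ≡⟨ cong (sumFrom g 0) (trans (sym (+-suc (treeSize h) (treeSize h)))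
                                 (cong (λ t → treeSize h + t) (sym (2^[1+h]≡1+treeSize[h] h)))) ⟩
  sumFrom g 0 (treeSize h + 2 ^ suc h)
    ≡⟨ sumFrom-+ g 0 (treeSize h) (2 ^ suc h) ⟩
  sumFrom g 0 (treeSize h) + sumFrom g (treeSize h) (2 ^ suc h)
    ≡⟨ cong₂ _+_ (sumFrom≡subtreeSum g h)
                 (sym (levelSum≡sumFrom g (suc h) 0 (treeSize h)
                        (trans (sym (2^[1+h]≡1+treeSize[h] h)) (sym (*-identityʳ _))))) ⟩
  subtreeSum g 0 h + levelSum g 0 (suc h)
    ≡⟨ sym (subtreeSum-suc g h 0) ⟩
  subtreeSum g 0 (suc h) ∎
  where open ≡-Reasoning

-- Subsets of the tree and their vertex boundary

_!_ : ∀ {n} → Vec Bool n → ℕ → Bool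
[] ! _ = false
(b ∷ _) ! zero = b
(_ ∷ bs) ! suc i = bs ! i

!-out-of-range : ∀ {n} (S : Vec Bool n) i → n ≤ i → S ! i ≡ false
!-out-of-range [] i _ = refl
!-out-of-range (_ ∷ S) (suc i) (s≤s n≤i) = !-out-of-range S i n≤i

!-true⇒< : ∀ {n} (S : Vec Bool n) i → T (S ! i) → i < n
!-true⇒< [] i ()
!-true⇒< (_ ∷ _) zero _ = s≤s z≤n
!-true⇒< (_ ∷ S) (suc i) t = s≤s (!-true⇒< S i t)

tabulate-! : ∀ {n} (F : Fin n → Bool) i (i<n : i < n) → tabulate F ! i ≡ F (fromℕ< i<n)
tabulate-! F zero (s≤s _) = refl
tabulate-! F (suc i) (s≤s i<n) = tabulate-! (λ v → F (Fin.suc v)) i i<n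

∈?≡! : ∀ {n} (v : Fin n) (S : Subset n) → does (v ∈? S) ≡ S ! toℕ v
∈?≡! Fin.zero (true ∷ S) = refl
∈?≡! Fin.zero (false ∷ S) = refl
∈?≡! (Fin.suc v) (_ ∷ S) = ∈?≡! v S

∣S∣≡sumFrom : ∀ {n} (S : Subset n) → ∣ S ∣ ≡ sumFrom (λ i → ⟦ S ! i ⟧) 0 n
∣S∣≡sumFrom [] = refl
∣S∣≡sumFrom {suc n} (true ∷ S) =
  cong suc (trans (∣S∣≡sumFrom S) (sym (sumFrom-suc (λ i → ⟦ (true ∷ S) ! i ⟧) 0 n)))
∣S∣≡sumFrom {suc n} (false ∷ S) =
  trans (∣S∣≡sumFrom S) (sym (sumFrom-suc (λ i → ⟦ (false ∷ S) ! i ⟧) 0 n))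

T-⇔-injective : ∀ {x y} → T x ⇔ T y → x ≡ y
T-⇔-injective {true} {true} _ = refl
T-⇔-injective {true} {false} x⇔y = ⊥-elim (Equivalence.to x⇔y _)
T-⇔-injective {false} {true} x⇔y = ⊥-elim (Equivalence.from x⇔y _)
T-⇔-injective {false} {false} _ = refl

T-anyFin : ∀ {n} (p : Fin n → Bool) → T (anyFin p) ⇔ ∃ λ u → T (p u)
T-anyFin {zero} p = mk⇔ (λ ()) (λ ())
T-anyFin {suc n} p = mk⇔ to from
  where
  to : T (anyFin p) → ∃ λ u → T (p u)
  to t with Equivalence.to T-∨ t
  ... | inj₁ t₀ = Fin.zero , t₀
  ... | inj₂ t₁ = let u , tu = Equivalence.to (T-anyFin (λ i → p (Fin.suc i))) t₁ in Fin.suc u , tu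
  from : (∃ λ u → T (p u)) → T (anyFin p)
  from (Fin.zero , t) = Equivalence.from T-∨ (inj₁ t)
  from (Fin.suc u , t) = Equivalence.from T-∨ (inj₂ (Equivalence.from (T-anyFin (λ i → p (Fin.suc i))) (u , t)))

IsChild : ℕ → ℕ → Set
IsChild i j = j ≡ left i ⊎ j ≡ right i

Adjacent : ℕ → ℕ → Set
Adjacent i j = IsChild i j ⊎ IsChild j i

IsChild-⌊n/2⌋ : ∀ n → IsChild ⌊ n /2⌋ (suc n)
IsChild-⌊n/2⌋ zero = inj₁ refl
IsChild-⌊n/2⌋ (suc zero) = inj₂ refl
IsChild-⌊n/2⌋ (suc (suc n)) rewrite +-suc ⌊ n /2⌋ ⌊ n /2⌋ =
  Data.Sum.map (cong (λ t → suc (suc t))) (cong (λ t → suc (suc t))) (IsChild-⌊n/2⌋ n)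

T-isChild : ∀ {n} (u v : Fin n) → T (isChild u v) ⇔ IsChild (toℕ u) (toℕ v)
T-isChild u v = mk⇔
  (λ t → Data.Sum.map (λ e → trans (≡ᵇ⇒≡ _ _ e) (2n+1 (toℕ u))) (λ e → trans (≡ᵇ⇒≡ _ _ e) (2n+2 (toℕ u)))
                      (Equivalence.to T-∨ t))
  (λ c → Equivalence.from T-∨ (Data.Sum.map (λ e → ≡⇒≡ᵇ _ _ (trans e (sym (2n+1 (toℕ u)))))
                                            (λ e → ≡⇒≡ᵇ _ _ (trans e (sym (2n+2 (toℕ u))))) c))
  where
  2n+1 : ∀ n → 2 * n + 1 ≡ suc (n + n)
  2n+1 = solve-∀
  2n+2 : ∀ n → 2 * n + 2 ≡ suc (suc (n + n))
  2n+2 = solve-∀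

T-adj : ∀ {n} (u v : Fin n) → T (adj u v) ⇔ Adjacent (toℕ u) (toℕ v)
T-adj u v = ⇔-trans T-∨ (mk⇔ (Data.Sum.map (Equivalence.to (T-isChild u v)) (Equivalence.to (T-isChild v u)))
                             (Data.Sum.map (Equivalence.from (T-isChild u v)) (Equivalence.from (T-isChild v u))))

module BoundaryOf (d : ℕ) (S : Subset (|T| d)) where

  open Subtrees (S !_) d (λ i le → !-out-of-range S i (subst (_≤ i) (sym (|T|≡treeSize d)) le)) public

  parentIn-child : ∀ {i j} → IsChild i j → parentIn j ≡ S ! i
  parentIn-child {i} (inj₁ refl) = parentIn-left i
  parentIn-child {i} (inj₂ refl) = parentIn-right i

  hasNeighbour⇔ : ∀ j → T (parentIn j ∨ S ! left j ∨ S ! right j) ⇔ ∃ λ i → T (S ! i) × Adjacent i j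
  hasNeighbour⇔ j = mk⇔ (to j) from
    where
    parent : ∀ j → T (parentIn j) → ∃ λ i → T (S ! i) × Adjacent i j
    parent (suc j) t = ⌊ j /2⌋ , t , inj₁ (IsChild-⌊n/2⌋ j)
    children : ∀ j → T (S ! left j ∨ S ! right j) → ∃ λ i → T (S ! i) × Adjacent i j
    children j t with Equivalence.to (T-∨ {S ! left j}) t
    ... | inj₁ tl = left j , tl , inj₂ (inj₁ refl)
    ... | inj₂ tr = right j , tr , inj₂ (inj₂ refl)
    to : ∀ j → T (parentIn j ∨ S ! left j ∨ S ! right j) → ∃ λ i → T (S ! i) × Adjacent i j
    to j t = Data.Sum.[ parent j , children j ] (Equivalence.to (T-∨ {parentIn j}) t)
    from : (∃ λ i → T (S ! i) × Adjacent i j) → T (parentIn j ∨ S ! left j ∨ S ! right j)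
    from (i , t , inj₁ c) = Equivalence.from (T-∨ {parentIn j}) (inj₁ (subst T (sym (parentIn-child c)) t))
    from (i , t , inj₂ (inj₁ refl)) =
      Equivalence.from (T-∨ {parentIn j}) (inj₂ (Equivalence.from (T-∨ {S ! left j}) (inj₁ t)))
    from (i , t , inj₂ (inj₂ refl)) =
      Equivalence.from (T-∨ {parentIn j}) (inj₂ (Equivalence.from (T-∨ {S ! left j}) (inj₂ t)))

  anyNeighbour⇔ : ∀ (v : Vertex d) →
    T (anyFin (λ u → does (u ∈? S) ∧ adj u v)) ⇔ ∃ λ i → T (S ! i) × Adjacent i (toℕ v)
  anyNeighbour⇔ v = ⇔-trans (T-anyFin _) (mk⇔ to from)
    where
    to : (∃ λ u → T (does (u ∈? S) ∧ adj u v)) → ∃ λ i → T (S ! i) × Adjacent i (toℕ v)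
    to (u , t) = let tu , ta = Equivalence.to T-∧ t in
      toℕ u , subst T (∈?≡! u S) tu , Equivalence.to (T-adj u v) ta
    from : (∃ λ i → T (S ! i) × Adjacent i (toℕ v)) → ∃ λ u → T (does (u ∈? S) ∧ adj u v)
    from (i , t , a) = u , Equivalence.from T-∧
        (subst T (sym (trans (∈?≡! u S) (cong (S !_) toℕu≡i))) t ,
         Equivalence.from (T-adj u v) (subst (λ k → Adjacent k (toℕ v)) (sym toℕu≡i) a))
      where
      u : Vertex d
      u = fromℕ< (!-true⇒< S i t)
      toℕu≡i : toℕ u ≡ i
      toℕu≡i = toℕ-fromℕ< (!-true⇒< S i t)

  δ-! : ∀ i → i < |T| d → δ S ! i ≡ boundary i
  δ-! i i< = begin
    δ S ! i
      ≡⟨ tabulate-! _ i i< ⟩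
    not (does (v ∈? S)) ∧ anyFin (λ u → does (u ∈? S) ∧ adj u v)
      ≡⟨ cong₂ (λ a b → not a ∧ b) (∈?≡! v S)
               (T-⇔-injective (⇔-trans (anyNeighbour⇔ v) (⇔-sym (hasNeighbour⇔ (toℕ v))))) ⟩
    boundary (toℕ v)
      ≡⟨ cong boundary (toℕ-fromℕ< i<) ⟩
    boundary i ∎
    where
    open ≡-Reasoning
    v : Vertex d
    v = fromℕ< i<

  ∣U∣≡subtreeSum : ∀ (g : ℕ → Bool) (U : Subset (|T| d)) → (∀ i → i < |T| d → U ! i ≡ g i) →
                   ∣ U ∣ ≡ subtreeSum (λ i → ⟦ g i ⟧) 0 d
  ∣U∣≡subtreeSum g U U≡g = begin
    ∣ U ∣                                        ≡⟨ ∣S∣≡sumFrom U ⟩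
    sumFrom (λ i → ⟦ U ! i ⟧) 0 (|T| d)          ≡⟨ sumFrom-cong 0 (|T| d) (λ i i< → cong ⟦_⟧ (U≡g i i<)) ⟩
    sumFrom (λ i → ⟦ g i ⟧) 0 (|T| d)            ≡⟨ cong (sumFrom (λ i → ⟦ g i ⟧) 0) (|T|≡treeSize d) ⟩
    sumFrom (λ i → ⟦ g i ⟧) 0 (treeSize d)       ≡⟨ sumFrom≡subtreeSum (λ i → ⟦ g i ⟧) d ⟩
    subtreeSum (λ i → ⟦ g i ⟧) 0 d               ∎
    where open ≡-Reasoning

  Approx-root : Approx ∣ δ S ∣ ∣ S ∣ (⟦ S ! 0 ∨ false ⟧ * treeSize d)
  Approx-root = subst₂ (λ k x → Approx k x (⟦ S ! 0 ∨ false ⟧ * treeSize d))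
    (sym (∣U∣≡subtreeSum boundary (δ S) δ-!)) (sym (∣U∣≡subtreeSum (S !_) S (λ _ _ → refl)))
    (subtree-Approx d 0 (≤-reflexive (sym (*-identityˡ (2 ^ d)))))

flips≤PowerSum : ∀ {j x} m n → PowerSum j x → flips n (x >> m) ≤ 2 * j
flips≤PowerSum {j} {x} m n p =
  subst₂ (λ a b → flips n (a >> m) ≤ b) (+-identityʳ x) (cong (_+ 2 * j) (flips-0 m n))
         (proj₁ (flips-+PowerSum m n 0 p))

flips-+high : ∀ b d m n x → m + n ≤ d → flips n ((⟦ b ⟧ * 2 ^ suc d + x) >> m) ≡ flips n (x >> m)
flips-+high true d m n x m+n≤d =
  trans (cong (λ t → flips n ((t + x) >> m)) (*-identityˡ (2 ^ suc d))) (flips-+2^-high (suc d) m n x (s≤s m+n≤d))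
flips-+high false d m n x _ = refl

-- Chain of estimates s ≈ N + s ≈ cN + b + N + s = b 2^(d+1) + cP + P, then ≈ cP + P ≈ P ≈ 0.
flips≤-Approx : ∀ {k s} d b m n → m + n ≤ d → 2 * k + 1 ≤ 2 ^ m →
  Approx k s (⟦ b ⟧ * treeSize d) → flips n (s >> m) ≤ 2 * k + 2
flips≤-Approx {k} {s} d b m n m+n≤d 2k+1≤2^m (approx jP jN P N cP cN P-sum N-sum j-bound c-bound balance) =
  begin
    F s                                ≤⟨ proj₂ (flips-+PowerSum m n s N-sum) ⟩
    F (N + s) + 2 * jN                 ≤⟨ +-monoˡ-≤ (2 * jN) (proj₂ (flips-+≤2^ m n (cN + ⟦ b ⟧) (N + s) c≤2^m)) ⟩
    F (cN + ⟦ b ⟧ + (N + s)) + 1 + 2 * jN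
      ≡⟨ cong (λ x → x + 1 + 2 * jN) (trans (cong F rebalance) (flips-+high b d m n (cP + P) m+n≤d)) ⟩
    F (cP + P) + 1 + 2 * jN            ≤⟨ +-monoˡ-≤ (2 * jN) (+-monoˡ-≤ 1 (proj₁ (flips-+≤2^ m n cP P cP≤2^m))) ⟩
    F P + 1 + 1 + 2 * jN               ≤⟨ +-monoˡ-≤ (2 * jN) (+-monoˡ-≤ 1 (+-monoˡ-≤ 1 (flips≤PowerSum m n P-sum))) ⟩
    2 * jP + 1 + 1 + 2 * jN            ≡⟨ collect jP jN ⟩
    2 * (jP + jN) + 2                  ≤⟨ +-monoˡ-≤ 2 (*-monoʳ-≤ 2 j-bound) ⟩
    2 * k + 2                          ∎
  where
  open ≤-Reasoning
  F : ℕ → ℕ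
  F x = flips n (x >> m)
  c≤2^m : cN + ⟦ b ⟧ ≤ 2 ^ m
  c≤2^m = ≤-trans (+-mono-≤ (≤-trans (m≤n+m cN cP) c-bound) (⟦⟧≤1 b)) 2k+1≤2^m
  cP≤2^m : cP ≤ 2 ^ m
  cP≤2^m = ≤-trans (≤-trans (m≤m+n cP cN) c-bound) (≤-trans (m≤m+n (2 * k) 1) 2k+1≤2^m)
  collect : ∀ a b → 2 * a + 1 + 1 + 2 * b ≡ 2 * (a + b) + 2
  collect = solve-∀
  rebalance : cN + ⟦ b ⟧ + (N + s) ≡ ⟦ b ⟧ * 2 ^ suc d + (cP + P)
  rebalance = begin-equality
    cN + ⟦ b ⟧ + (N + s)                  ≡⟨ swap₁ cN ⟦ b ⟧ N s ⟩
    s + N + cN + ⟦ b ⟧                    ≡⟨ cong (_+ ⟦ b ⟧) balance ⟩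
    ⟦ b ⟧ * treeSize d + P + cP + ⟦ b ⟧   ≡⟨ swap₂ ⟦ b ⟧ (treeSize d) P cP ⟩
    ⟦ b ⟧ * suc (treeSize d) + (cP + P)   ≡⟨ cong (λ t → ⟦ b ⟧ * t + (cP + P)) (sym (2^[1+h]≡1+treeSize[h] d)) ⟩
    ⟦ b ⟧ * 2 ^ suc d + (cP + P)          ∎
    where
    swap₁ : ∀ c e n s → c + e + (n + s) ≡ s + n + c + e
    swap₁ = solve-∀
    swap₂ : ∀ e t p c → e * t + p + c + e ≡ e * suc t + (c + p)
    swap₂ = solve-∀

flips-∣S∣≤2∣δS∣+2 : ∀ d (S : Subset (|T| d)) m n → m + n ≤ d → 2 * ∣ δ S ∣ + 1 ≤ 2 ^ m →
  flips n (∣ S ∣ >> m) ≤ 2 * ∣ δ S ∣ + 2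
flips-∣S∣≤2∣δS∣+2 d S m n m+n≤d small =
  flips≤-Approx d (S ! 0 ∨ false) m n m+n≤d small (BoundaryOf.Approx-root d S)

n≤2∣δS∣+2 : ∀ d m n (S : Subset (|T| d)) → m + n ≤ d → d ≤ 2 ^ m →
  ∣ S ∣ ≡ 2 ^ m * alternating n → n ≤ 2 * ∣ δ S ∣ + 2
n≤2∣δS∣+2 d m n S m+n≤d d≤2^m ∣S∣≡ with 2 * ∣ δ S ∣ + 1 ≤? 2 ^ m
... | yes small = begin
  n                            ≡⟨ sym (flips-alternating n) ⟩
  flips n (alternating n)      ≡⟨ cong (flips n) (sym ([2^m*n]>>m≡n m (alternating n))) ⟩
  flips n ((2 ^ m * alternating n) >> m) ≡⟨ cong (λ x → flips n (x >> m)) (sym ∣S∣≡) ⟩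
  flips n (∣ S ∣ >> m)          ≤⟨ flips-∣S∣≤2∣δS∣+2 d S m n m+n≤d small ⟩
  2 * ∣ δ S ∣ + 2               ∎
  where open ≤-Reasoning
... | no large = begin
  n                            ≤⟨ m+n≤o⇒n≤o m m+n≤d ⟩
  d                            ≤⟨ d≤2^m ⟩
  2 ^ m                        ≤⟨ <⇒≤ (≰⇒> large) ⟩
  2 * ∣ δ S ∣ + 1              ≤⟨ +-monoʳ-≤ (2 * ∣ δ S ∣) (n≤1+n 1) ⟩
  2 * ∣ δ S ∣ + 2               ∎
  where open ≤-Reasoning

2^m*alternating≤|T| : ∀ d m n → m + n ≤ d → 2 ^ m * alternating n ≤ |T| d
2^m*alternating≤|T| d m n m+n≤d = subst (_ ≤_) (sym (|T|≡treeSize d)) (≤-pred (begin-strict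
  2 ^ m * alternating n   <⟨ *-monoʳ-< (2 ^ m) {{m^n≢0 2 m}} (alternating<2^ n) ⟩
  2 ^ m * 2 ^ n           ≡⟨ sym (^-distribˡ-+-* 2 m n) ⟩
  2 ^ (m + n)             ≤⟨ ^-monoʳ-≤ 2 (m≤n⇒m≤1+n m+n≤d) ⟩
  2 ^ suc d               ≡⟨ 2^[1+h]≡1+treeSize[h] d ⟩
  suc (treeSize d)        ∎))
  where open ≤-Reasoning

Φ-witness : ∀ d L → 1 ≤ d → L ≤ suc d → 2 * d ≤ 2 ^ L →
  ∃ λ s → s ≤ |T| d × (∀ (S : Subset (|T| d)) → ∣ S ∣ ≡ s → d ≤ 2 * ∣ δ S ∣ + 1 + L)
Φ-witness d zero 1≤d _ 2d≤1 = contradiction (≤-trans (*-monoʳ-≤ 2 1≤d) 2d≤1) λ { (s≤s ()) }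
Φ-witness d (suc m) _ (s≤s m≤d) 2d≤2^[1+m] =
  2 ^ m * alternating n , 2^m*alternating≤|T| d m n m+n≤d , large
  where
  n : ℕ
  n = d ∸ m
  m+n≡d : m + n ≡ d
  m+n≡d = m+[n∸m]≡n m≤d
  m+n≤d : m + n ≤ d
  m+n≤d = ≤-reflexive m+n≡d
  large : ∀ (S : Subset (|T| d)) → ∣ S ∣ ≡ 2 ^ m * alternating n → d ≤ 2 * ∣ δ S ∣ + 1 + suc m
  large S ∣S∣≡ = begin
    d                            ≡⟨ sym m+n≡d ⟩
    m + n                        ≤⟨ +-monoʳ-≤ m (n≤2∣δS∣+2 d m n S m+n≤d (*-cancelˡ-≤ 2 2d≤2^[1+m]) ∣S∣≡) ⟩
    m + (2 * ∣ δ S ∣ + 2)        ≡⟨ shape m (∣ δ S ∣) ⟩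
    2 * ∣ δ S ∣ + 1 + suc m      ∎
    where
    open ≤-Reasoning
    shape : ∀ m k → m + (2 * k + 2) ≡ 2 * k + 1 + suc m
    shape = solve-∀

-- Logarithms and rounding

n≤2*⌈n/2⌉ : ∀ n → n ≤ 2 * ℕ.⌈ n /2⌉
n≤2*⌈n/2⌉ n = begin
  n                              ≡⟨ sym (⌊n/2⌋+⌈n/2⌉≡n n) ⟩
  ⌊ n /2⌋ + ℕ.⌈ n /2⌉            ≤⟨ +-monoˡ-≤ ℕ.⌈ n /2⌉ (⌊n/2⌋≤⌈n/2⌉ n) ⟩
  ℕ.⌈ n /2⌉ + ℕ.⌈ n /2⌉          ≡⟨ cong (λ t → ℕ.⌈ n /2⌉ + t) (sym (+-identityʳ ℕ.⌈ n /2⌉)) ⟩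
  2 * ℕ.⌈ n /2⌉                  ∎
  where open ≤-Reasoning

2*⌊n/2⌋≤n : ∀ n → 2 * ⌊ n /2⌋ ≤ n
2*⌊n/2⌋≤n n = begin
  2 * ⌊ n /2⌋                    ≡⟨ cong (λ t → ⌊ n /2⌋ + t) (+-identityʳ ⌊ n /2⌋) ⟩
  ⌊ n /2⌋ + ⌊ n /2⌋              ≤⟨ +-monoʳ-≤ ⌊ n /2⌋ (⌊n/2⌋≤⌈n/2⌉ n) ⟩
  ⌊ n /2⌋ + ℕ.⌈ n /2⌉            ≡⟨ ⌊n/2⌋+⌈n/2⌉≡n n ⟩
  n                              ∎
  where open ≤-Reasoning

n≤2^⌈log₂n⌉ : ∀ n → n ≤ 2 ^ ⌈log₂ n ⌉
n≤2^⌈log₂n⌉ n = go n (<-wellFounded n)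
  where
  go : ∀ n (rec : Acc _<_ n) → n ≤ 2 ^ ⌈log2⌉ n rec
  go zero _ = z≤n
  go (suc zero) _ = ≤-refl
  go (suc (suc n)) (acc rs) = ≤-trans (subst (suc (suc n) ≤_) (2+2c ℕ.⌈ n /2⌉) (s≤s (s≤s (n≤2*⌈n/2⌉ n))))
                                      (*-monoʳ-≤ 2 (go (suc ℕ.⌈ n /2⌉) _))
    where 2+2c : ∀ c → suc (suc (2 * c)) ≡ 2 * suc c
          2+2c = solve-∀

2^⌈log₂n⌉+2≤2n : ∀ n → 2 ≤ n → 2 ^ ⌈log₂ n ⌉ + 2 ≤ 2 * n
2^⌈log₂n⌉+2≤2n (suc zero) (s≤s ())
2^⌈log₂n⌉+2≤2n (suc (suc n)) _ = go n (<-wellFounded (suc (suc n)))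
  where
  step : ∀ {n h} x → x + 2 ≤ 2 * suc (suc h) → 2 * h ≤ n → 2 * x + 2 ≤ 2 * suc (suc (suc n))
  step {n} {h} x ih 2h≤n = begin
    2 * x + 2                   ≤⟨ +-monoˡ-≤ 2 (*-monoʳ-≤ 2 (+-cancelʳ-≤ 2 x (n + 2) (begin
      x + 2                       ≤⟨ ih ⟩
      2 * suc (suc h)             ≡⟨ shape₁ h ⟩
      2 * h + 2 + 2               ≤⟨ +-monoˡ-≤ 2 (+-monoˡ-≤ 2 2h≤n) ⟩
      n + 2 + 2                   ∎))) ⟩
    2 * (n + 2) + 2             ≡⟨ shape₂ n ⟩
    2 * suc (suc (suc n))       ∎
    where
    open ≤-Reasoning
    shape₁ : ∀ h → 2 * suc (suc h) ≡ 2 * h + 2 + 2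
    shape₁ = solve-∀
    shape₂ : ∀ n → 2 * (n + 2) + 2 ≡ 2 * suc (suc (suc n))
    shape₂ = solve-∀
  go : ∀ n (rec : Acc _<_ (suc (suc n))) → 2 ^ ⌈log2⌉ (suc (suc n)) rec + 2 ≤ 2 * suc (suc n)
  go zero (acc _) = ≤-refl
  go (suc n) (acc rs) = step _ (go ⌊ n /2⌋ (rs _)) (2*⌊n/2⌋≤n n)

2^m<n : ∀ m n → 2 ≤ n → m < ⌈log₂ n ⌉ → 2 ^ m < n
2^m<n m n 2≤n m<L = *-cancelˡ-< 2 (2 ^ m) n (begin-strict
  2 ^ suc m             ≤⟨ ^-monoʳ-≤ 2 m<L ⟩
  2 ^ ⌈log₂ n ⌉         <⟨ m<m+n _ (s≤s z≤n) ⟩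
  2 ^ ⌈log₂ n ⌉ + 2     ≤⟨ 2^⌈log₂n⌉+2≤2n n 2≤n ⟩
  2 * n                 ∎)
  where open ≤-Reasoning

3n≤2^[1+n] : ∀ n → 3 * n ≤ 2 ^ suc n
3n≤2^[1+n] zero = z≤n
3n≤2^[1+n] (suc zero) = s≤s (s≤s (s≤s z≤n))
3n≤2^[1+n] (suc (suc n)) = begin
  3 * suc (suc n)                     ≡⟨ shape n ⟩
  3 * suc n + 3                       ≤⟨ +-mono-≤ (3n≤2^[1+n] (suc n)) 3≤2^[2+n] ⟩
  2 ^ suc (suc n) + 2 ^ suc (suc n)   ≡⟨ sym (2^[1+n]≡2^n+2^n (suc (suc n))) ⟩
  2 ^ suc (suc (suc n))               ∎
  where
  open ≤-Reasoning
  shape : ∀ n → 3 * suc (suc n) ≡ 3 * suc n + 3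
  shape = solve-∀
  3≤2^[2+n] : 3 ≤ 2 ^ suc (suc n)
  3≤2^[2+n] = ≤-trans (n≤1+n 3) (^-monoʳ-≤ 2 {2} {suc (suc n)} (s≤s (s≤s z≤n)))

2n≤2^⌈log₂3n⌉ : ∀ n → 2 * n ≤ 2 ^ ⌈log₂ (3 * n) ⌉
2n≤2^⌈log₂3n⌉ n = ≤-trans (*-monoˡ-≤ n {2} {3} (n≤1+n 2)) (n≤2^⌈log₂n⌉ (3 * n))

⌈log₂3n⌉≤1+n : ∀ n → ⌈log₂ (3 * n) ⌉ ≤ suc n
⌈log₂3n⌉≤1+n n = subst (⌈log₂ (3 * n) ⌉ ≤_) (⌈log₂2^n⌉≡n (suc n)) (⌈log₂⌉-mono-≤ (3n≤2^[1+n] n))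

/2≤ : ∀ x k → x ℤ.≤ + (2 * k + 1) → x / + 2 ℤ.≤ + k
/2≤ x k x≤2k+1 = halve (x / + 2) ([n/d]*d≤n x (+ 2))
  where
  halve : ∀ b → b ℤ.* + 2 ℤ.≤ x → b ℤ.≤ + k
  halve -[1+ _ ] _ = ℤ.-≤+
  halve (+ b) 2b≤x = ℤ.+≤+ (≤-pred (*-cancelʳ-< 2 b (suc k) (begin-strict
    b * 2          ≤⟨ ℤP.drop‿+≤+ (ℤP.≤-trans (ℤP.≤-reflexive (ℤP.pos-* b 2)) (ℤP.≤-trans 2b≤x x≤2k+1)) ⟩
    2 * k + 1      <⟨ ≤-reflexive (shape k) ⟩
    suc k * 2      ∎)))
    where
    open ≤-Reasoning
    shape : ∀ k → suc (2 * k + 1) ≡ suc k * 2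
    shape = solve-∀

x≤[x/2]*2+1 : ∀ x → x ℤ.≤ x / + 2 ℤ.* + 2 ℤ.+ + 1
x≤[x/2]*2+1 x = begin
  x                                  ≡⟨ a≡a%n+[a/n]*n x (+ 2) ⟩
  + (x % + 2) ℤ.+ x / + 2 ℤ.* + 2    ≤⟨ ℤP.+-monoˡ-≤ (x / + 2 ℤ.* + 2) (ℤ.+≤+ (≤-pred (n%d<d x (+ 2)))) ⟩
  + 1 ℤ.+ x / + 2 ℤ.* + 2            ≡⟨ ℤP.+-comm (+ 1) (x / + 2 ℤ.* + 2) ⟩
  x / + 2 ℤ.* + 2 ℤ.+ + 1            ∎
  where open ℤP.≤-Reasoning

⌊[d-L]/2⌋≤ : ∀ d L k → d ≤ 2 * k + 1 + L → (+ d ℤ.- + L) / + 2 ℤ.≤ + k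
⌊[d-L]/2⌋≤ d L k d≤ = /2≤ (+ d ℤ.- + L) k (begin
  + d ℤ.- + L                      ≤⟨ ℤP.+-monoˡ-≤ (ℤ.- + L) (ℤ.+≤+ d≤) ⟩
  + (2 * k + 1 + L) ℤ.- + L        ≡⟨ cong (ℤ._- + L) (ℤP.pos-+ (2 * k + 1) L) ⟩
  + (2 * k + 1) ℤ.+ + L ℤ.- + L    ≡⟨ cancel (+ (2 * k + 1)) (+ L) ⟩
  + (2 * k + 1)                    ∎)
  where
  open ℤP.≤-Reasoning
  cancel : ∀ a b → a ℤ.+ b ℤ.- b ≡ a
  cancel = ZS.solve-∀

⌊[d-L]/2⌋-≥ : ∀ d L m → + m ℤ.≤ + d ℤ.- + 3 ℤ.- + 2 ℤ.* ((+ d ℤ.- + L) / + 2) → m + 2 ≤ L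
⌊[d-L]/2⌋-≥ d L m m≤ = ℤP.drop‿+≤+ (begin
  + (m + 2)                          ≡⟨ ℤP.pos-+ m 2 ⟩
  + m ℤ.+ + 2                        ≤⟨ ℤP.+-monoˡ-≤ (+ 2) m≤ ⟩
  + d ℤ.- + 3 ℤ.- + 2 ℤ.* b ℤ.+ + 2  ≡⟨ regroup (+ d) b ⟩
  + d ℤ.- (b ℤ.* + 2 ℤ.+ + 1)        ≤⟨ ℤP.+-monoʳ-≤ (+ d) (ℤP.neg-mono-≤ (x≤[x/2]*2+1 (+ d ℤ.- + L))) ⟩
  + d ℤ.- (+ d ℤ.- + L)              ≡⟨ cancel (+ d) (+ L) ⟩
  + L                                ∎)
  where
  open ℤP.≤-Reasoning
  b : ℤ.ℤ
  b = (+ d ℤ.- + L) / + 2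
  regroup : ∀ d b → d ℤ.- + 3 ℤ.- + 2 ℤ.* b ℤ.+ + 2 ≡ d ℤ.- (b ℤ.* + 2 ℤ.+ + 1)
  regroup = ZS.solve-∀
  cancel : ∀ d l → d ℤ.- (d ℤ.- l) ≡ l
  cancel = ZS.solve-∀

theorem3p3 : ∀ (d : ℕ) → 1 ≤ d →
    ΦV≥ d (bound d) ×
    (∀ (m : ℕ) → + m ℤ.≤ + d ℤ.- + 3 ℤ.- + 2 ℤ.* bound d → 2 ^ m ≤ 3 * d)
theorem3p3 d 1≤d with Φ-witness d ⌈log₂ (3 * d) ⌉ 1≤d (⌈log₂3n⌉≤1+n d) (2n≤2^⌈log₂3n⌉ d)
... | s , s≤|T| , large =
  (s , s≤|T| , λ S ∣S∣≡s → ⌊[d-L]/2⌋≤ d _ ∣ δ S ∣ (large S ∣S∣≡s)) ,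
  λ m m≤ → <⇒≤ (2^m<n m (3 * d) 2≤3d (<-≤-trans (m<m+n m (s≤s z≤n)) (⌊[d-L]/2⌋-≥ d _ m m≤)))
  where
  2≤3d : 2 ≤ 3 * d
  2≤3d = ≤-trans (n≤1+n 2) (*-monoʳ-≤ 3 1≤d)
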